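{- Let $n\geq 2$ be an integer and $R\cong \prod_{i=1}^{n}\mathbb{F}_{i}$, where each $\mathbb{F}_{i}$ is a field. Then $sdim(G(R))=2^{n}-2^{n-1}-1$.
   Context: All rings are commutative with identity. $I(R)$ is the set of non-trivial (nonzero proper) ideals of $R$; $G(R)$ is the graph with vertex set $I(R)$ in which distinct $I,J$ are adjacent iff $I\cap J\neq 0$. For a graph $G$ with distance $d$, two vertices $u,v$ are strongly resolved by a vertex $w$ if $d(w,u)=d(w,v)+d(v,u)$ or $d(w,v)=d(w,u)+d(u,v)$. A set $W$ of vertices is a strong resolving set if every two distinct vertices are strongly resolved by some vertex of $W$; $sdim(G)$ is the minimum cardinality of a strong resolving set. -}

module Defs where

open import Level using (Level; _⊔_) renaming (suc to lsuc)
open import Algebra.Bundles using (CommutativeRing)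
open import Data.Nat using (ℕ; zero; suc; _<_) renaming (_+_ to _+ℕ_)
open import Data.Fin using (Fin)
open import Data.Product using (Σ; ∃; _×_; _,_)
open import Data.Sum using (_⊎_)
open import Data.List using (List; length)
open import Data.List.Relation.Unary.Any using (Any)
open import Relation.Nullary using (¬_)
open import Relation.Binary.PropositionalEquality using (_≡_)

record IsField {c ℓ} (F : CommutativeRing c ℓ) : Set (c ⊔ ℓ) where
  open CommutativeRing F
  field
    0≉1 : ¬ (0# ≈ 1#)
    inverse : ∀ x → ¬ (x ≈ 0#) → ∃ λ y → (x * y) ≈ 1#

record RingIsoToProduct {c ℓ c' ℓ'} {n : ℕ} (R : CommutativeRing c ℓ)
       (F : Fin n → CommutativeRing c' ℓ') : Set (c ⊔ ℓ ⊔ c' ⊔ ℓ') where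
  private
    module R = CommutativeRing R
    module F (i : Fin n) = CommutativeRing (F i)
  field
    φ          : R.Carrier → (i : Fin n) → F.Carrier i
    φ-cong     : ∀ {x y} → x R.≈ y → ∀ i → F._≈_ i (φ x i) (φ y i)
    φ-injective : ∀ {x y} → (∀ i → F._≈_ i (φ x i) (φ y i)) → x R.≈ y
    φ-surjective : (v : (i : Fin n) → F.Carrier i) →
                   ∃ λ x → ∀ i → F._≈_ i (φ x i) (v i)
    φ-+        : ∀ x y i → F._≈_ i (φ (x R.+ y) i) (F._+_ i (φ x i) (φ y i))
    φ-*        : ∀ x y i → F._≈_ i (φ (x R.* y) i) (F._*_ i (φ x i) (φ y i))
    φ-1        : ∀ i → F._≈_ i (φ R.1# i) (F.1# i)

module _ {c ℓ} (R : CommutativeRing c ℓ) where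
  open CommutativeRing R

  record Ideal : Set (lsuc (c ⊔ ℓ)) where
    field
      _∈I   : Carrier → Set (c ⊔ ℓ)
      ∈-resp : ∀ {x y} → x ≈ y → x ∈I → y ∈I
      0∈    : 0# ∈I
      +-closed : ∀ {x y} → x ∈I → y ∈I → (x + y) ∈I
      *-closed : ∀ r {x} → x ∈I → (r * x) ∈I
  open Ideal public

  NonTrivial : Ideal → Set (c ⊔ ℓ)
  NonTrivial I = (∃ λ x → (_∈I I x) × ¬ (x ≈ 0#)) × ¬ (_∈I I 1#)

  Vertex : Set (lsuc (c ⊔ ℓ))
  Vertex = Σ Ideal NonTrivial

  _≐_ : Vertex → Vertex → Set (c ⊔ ℓ)
  (I , _) ≐ (J , _) = ∀ x → ((_∈I I x) → (_∈I J x)) × ((_∈I J x) → (_∈I I x))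

  Adj : Vertex → Vertex → Set (c ⊔ ℓ)
  Adj u@(I , _) v@(J , _) = ¬ (u ≐ v) × ∃ λ x → (_∈I I x) × (_∈I J x) × ¬ (x ≈ 0#)

  data Walk : Vertex → Vertex → ℕ → Set (lsuc (c ⊔ ℓ)) where
    here : ∀ {u v} → u ≐ v → Walk u v 0
    step : ∀ {u w v k} → Adj u w → Walk w v k → Walk u v (suc k)

data ℕ∞ : Set where
  fin : ℕ → ℕ∞
  ∞   : ℕ∞

_+∞_ : ℕ∞ → ℕ∞ → ℕ∞
fin a +∞ fin b = fin (a +ℕ b)
fin _ +∞ ∞ = ∞
∞ +∞ _ = ∞

module _ {c ℓ} (R : CommutativeRing c ℓ) where

  Dist : Vertex R → Vertex R → ℕ∞ → Set (lsuc (c ⊔ ℓ))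
  Dist u v (fin k) = Walk R u v k × (∀ m → m < k → ¬ Walk R u v m)
  Dist u v ∞       = ∀ k → ¬ Walk R u v k

  StronglyResolves : Vertex R → Vertex R → Vertex R → Set (lsuc (c ⊔ ℓ))
  StronglyResolves w u v =
      (∃ λ a → ∃ λ b → ∃ λ d → Dist w u a × Dist w v b × Dist v u d × a ≡ b +∞ d)
    ⊎ (∃ λ a → ∃ λ b → ∃ λ d → Dist w v a × Dist w u b × Dist u v d × a ≡ b +∞ d)

  StrongResolving : List (Vertex R) → Set (lsuc (c ⊔ ℓ))
  StrongResolving W = ∀ u v → ¬ (_≐_ R u v) → Any (λ w → StronglyResolves w u v) W

  SDim : ℕ → Set (lsuc (c ⊔ ℓ))
  SDim m = (∃ λ W → length W ≡ m × StrongResolving W)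
         × (∀ W → StrongResolving W → m Data.Nat.≤ length W)

-- Through the coordinates of R ≅ ∏ Fᵢ, every nonzero proper ideal is the set of
-- elements vanishing outside its support, a nonempty proper subset of Fin n, and
-- two such ideals are adjacent in G(R) exactly when their supports meet.  A vertex
-- other than S and its complement ∁S lies within distance 2 of both (directly,
-- or through the vertex whose support is the union of its own and S), while S
-- and ∁S are at distance at least 2; so only S and ∁S strongly resolve the pair
-- {S, ∁S}, and a strong resolving set meets each of these 2ⁿ⁻¹ − 1 pairs.
-- Conversely the supports avoiding 0 form a strong resolving set: such a vertex
-- resolves every pair it belongs to, and if 0 lies in both supports of u ≠ v
-- and i ∈ supp v ∖ supp u, the vertex w with support supp v ∖ supp u gives an
-- induced path w – v – u.

module Submission where

open import Defs hiding (_≐_; Adj; Walk; Dist; StronglyResolves)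
import Defs
open import Axiom.ExcludedMiddle using (ExcludedMiddle)
open import Algebra.Bundles using (CommutativeRing)
import Algebra.Properties.Group as GroupProperties
open import Level using (Lift; lift; lower; _⊔_) renaming (suc to lsuc)
open import Data.Bool using (Bool; true; false; not; _∧_; _∨_; _xor_; if_then_else_; _≟_)
open import Data.Bool.Properties
  using (¬-not; ⇔→≡; not-involutive; not-injective; ∨-zeroʳ; ∧-zeroʳ; ∧-identityʳ; ∧-distribˡ-∨; T-≡)
open import Data.Fin using (Fin; zero; suc; toℕ; finToFun; funToFin; combine)
open import Data.Fin.Properties
  using (any?; 2↔Bool; funToFin-finToFin; suc-injective; injective⇒≤; toℕ<n; toℕ-injective)
open import Data.List using (List; []; _∷_; map; _++_; length; lookup)
open import Data.List.Properties using (length-map; length-++)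
open import Data.List.Relation.Unary.Any as Any using (Any; here)
open import Data.List.Relation.Unary.Any.Properties using (++⁺ˡ; ++⁺ʳ; map⁺; lookup-index)
open import Data.Nat using (ℕ; zero; suc; _^_; _∸_; _≤_; _<_; z≤n; s≤s; _<ᵇ_; _≡ᵇ_)
open import Data.Nat.Properties
  using (+-identityʳ; +-∸-assoc; m^n>0; ∸-monoˡ-≤; m+n∸m≡n; ≤-refl; ≤-trans; <-irrefl; <⇒≱; ≮⇒≥;
         +-mono-≤; <⇒<ᵇ; ≡ᵇ⇒≡)
open import Data.Nat using () renaming (_+_ to _+ℕ_)
open import Data.Nat.Induction using (<-rec)
open import Data.Product using (Σ; ∃; _×_; _,_; proj₁; proj₂; swap)
open import Data.Sum using (_⊎_; inj₁; inj₂)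
import Data.Sum as Sum
open import Data.Vec.Functional as Vec using (head; tail)
open import Function using (id; _∘_)
open import Function.Bundles using (Injection; Equivalence; mk⇔)
open import Function.Properties.Inverse using (↔⇒↣)
open import Relation.Nullary using (¬_; Dec; yes; no; does; contradiction)
open import Relation.Nullary.Decidable using (dec-true; dec-false; decidable-stable)
open import Relation.Binary.PropositionalEquality as ≡ using (_≡_; _≢_; refl; _≗_; module ≡-Reasoning)

∧≡true : ∀ {a b} → a ∧ b ≡ true → a ≡ true × b ≡ true
∧≡true {true} {true} _ = refl , refl

false-both : ∀ {a b} → (a ≡ true → b ≡ false) → a ≢ not b → a ≡ false × b ≡ false
false-both {true}  {true}  disjoint _ = contradiction (disjoint refl) λ ()
false-both {true}  {false} _ a≢¬b = contradiction refl a≢¬b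
false-both {false} {true}  _ a≢¬b = contradiction refl a≢¬b
false-both {false} {false} _ _    = refl , refl

<ᵇ-suc : ∀ m k → (m <ᵇ suc k) ≡ (m <ᵇ k) ∨ (m ≡ᵇ k)
<ᵇ-suc zero    zero    = refl
<ᵇ-suc zero    (suc k) = refl
<ᵇ-suc (suc m) zero    = refl
<ᵇ-suc (suc m) (suc k) = <ᵇ-suc m k

Sub : ℕ → Set
Sub k = Fin k → Bool

Nonempty : ∀ {k} → Sub k → Set
Nonempty S = ∃ λ i → S i ≡ true

Proper : ∀ {k} → Sub k → Set
Proper S = ∃ λ i → S i ≡ false

Meet : ∀ {k} → Sub k → Sub k → Set
Meet S T = ∃ λ i → S i ≡ true × T i ≡ true

infixr 6 _∩_
infixr 5 _∪_

_∩_ : ∀ {k} → Sub k → Sub k → Sub k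
(S ∩ T) i = S i ∧ T i

_∪_ : ∀ {k} → Sub k → Sub k → Sub k
(S ∪ T) i = S i ∨ T i

infixl 6 _∖_

_∖_ : ∀ {k} → Sub k → Sub k → Sub k
(S ∖ T) i = S i ∧ not (T i)

∷-≗ : ∀ {k b} {h : Sub k} {g : Sub (suc k)} → b ≡ head g → h ≗ tail g → (b Vec.∷ h) ≗ g
∷-≗ b≡ h≗ zero    = b≡
∷-≗ b≡ h≗ (suc i) = h≗ i

tail-nonempty : ∀ {k} {S : Sub (suc k)} → S zero ≡ false → Nonempty S → Nonempty (tail S)
tail-nonempty S₀ (zero  , S₀≡true) = contradiction (≡.trans (≡.sym S₀) S₀≡true) λ ()
tail-nonempty S₀ (suc i , Sᵢ)      = i , Sᵢ

subsets : ∀ k → List (Sub k)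
subsets zero    = (λ ()) ∷ []
subsets (suc k) = map (true Vec.∷_) (subsets k) ++ map (false Vec.∷_) (subsets k)

length-subsets : ∀ k → length (subsets k) ≡ 2 ^ k
length-subsets zero    = refl
length-subsets (suc k) = begin
  length (map (true Vec.∷_) Sₖ ++ map (false Vec.∷_) Sₖ) ≡⟨ length-++ (map (true Vec.∷_) Sₖ) ⟩
  length (map (true Vec.∷_) Sₖ) +ℕ length (map (false Vec.∷_) Sₖ)
    ≡⟨ ≡.cong₂ _+ℕ_ (length-map (true Vec.∷_) Sₖ) (length-map (false Vec.∷_) Sₖ) ⟩
  length Sₖ +ℕ length Sₖ                                  ≡⟨ ≡.cong₂ _+ℕ_ (length-subsets k) (length-subsets k) ⟩
  2 ^ k +ℕ 2 ^ k                                          ≡⟨ ≡.cong (2 ^ k +ℕ_) (≡.sym (+-identityʳ (2 ^ k))) ⟩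
  2 ^ suc k                                              ∎
  where
  open ≡-Reasoning

  Sₖ : List (Sub k)
  Sₖ = subsets k

∈-subsets : ∀ {k} (g : Sub k) → Any (_≗ g) (subsets k)
∈-subsets {zero}  g = here (λ ())
∈-subsets {suc k} g with g zero in g₀
... | true  = ++⁺ˡ (map⁺ (Any.map (∷-≗ (≡.sym g₀)) (∈-subsets (tail g))))
... | false = ++⁺ʳ _ (map⁺ (Any.map (∷-≗ (≡.sym g₀)) (∈-subsets (tail g))))

nonemptySubsets : ∀ k → List (Σ (Sub k) Nonempty)
nonemptySubsets zero    = []
nonemptySubsets (suc k) =
  map (λ g → true Vec.∷ g , zero , refl) (subsets k) ++
  map (λ (g , i , gᵢ) → false Vec.∷ g , suc i , gᵢ) (nonemptySubsets k)

length-nonemptySubsets : ∀ k → length (nonemptySubsets k) ≡ 2 ^ k ∸ 1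
length-nonemptySubsets zero    = refl
length-nonemptySubsets (suc k) = begin
  length (map _ (subsets k) ++ map _ (nonemptySubsets k))   ≡⟨ length-++ (map _ (subsets k)) ⟩
  length (map _ (subsets k)) +ℕ length (map _ (nonemptySubsets k))
    ≡⟨ ≡.cong₂ _+ℕ_ (length-map _ (subsets k)) (length-map _ (nonemptySubsets k)) ⟩
  length (subsets k) +ℕ length (nonemptySubsets k)
    ≡⟨ ≡.cong₂ _+ℕ_ (length-subsets k) (length-nonemptySubsets k) ⟩
  2 ^ k +ℕ (2 ^ k ∸ 1)                                       ≡⟨ +-∸-assoc (2 ^ k) (m^n>0 2 k) ⟨
  2 ^ k +ℕ 2 ^ k ∸ 1                                         ≡⟨ ≡.cong (λ x → 2 ^ k +ℕ x ∸ 1) (≡.sym (+-identityʳ (2 ^ k))) ⟩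
  2 ^ suc k ∸ 1                                             ∎
  where open ≡-Reasoning

∈-nonemptySubsets : ∀ {k} (g : Sub k) → Nonempty g → Any ((_≗ g) ∘ proj₁) (nonemptySubsets k)
∈-nonemptySubsets {suc k} g (i , gᵢ) with g zero in g₀
... | true  = ++⁺ˡ (map⁺ (Any.map (∷-≗ (≡.sym g₀)) (∈-subsets (tail g))))
... | false = ++⁺ʳ _ (map⁺ (Any.map (∷-≗ (≡.sym g₀)) (∈-nonemptySubsets (tail g) tail-g-nonempty)))
  where
  tail-g-nonempty : Nonempty (tail g)
  tail-g-nonempty = tail-nonempty {S = g} g₀ (i , gᵢ)

funToFin-cong : ∀ {k l} {f g : Fin k → Fin l} → f ≗ g → funToFin f ≡ funToFin g
funToFin-cong {zero}  f≗g = refl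
funToFin-cong {suc k} f≗g = ≡.cong₂ combine (f≗g zero) (funToFin-cong (f≗g ∘ suc))

2^k≤-of-injection : ∀ {k L} (h : Sub k → Fin L) → (∀ g g' → h g ≡ h g' → g ≗ g') → 2 ^ k ≤ L
2^k≤-of-injection {k} {L} h h-injective = injective⇒≤ f-injective
  where
  open Injection (↔⇒↣ 2↔Bool) using (to; injective)

  f : Fin (2 ^ k) → Fin L
  f x = h (to ∘ finToFun x)

  f-injective : ∀ {x y} → f x ≡ f y → x ≡ y
  f-injective {x} {y} fx≡fy = begin
    x                              ≡⟨ funToFin-finToFin {k} {2} x ⟨
    funToFin (finToFun {2} {k} x)  ≡⟨ funToFin-cong (injective ∘ h-injective _ _ fx≡fy) ⟩
    funToFin (finToFun {2} {k} y)  ≡⟨ funToFin-finToFin {k} {2} y ⟩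
    y                              ∎
    where open ≡-Reasoning

-- Sending g to the position of one of its codes, and the empty subset to a
-- fresh position, is injective.
covering⇒2^k∸1≤length : ∀ {a} {A : Set a} {k} (code : A → Sub k) (xs : List A) →
  (∀ g → Nonempty g → Any (λ x → code x ≗ g) xs) → 2 ^ k ∸ 1 ≤ length xs
covering⇒2^k∸1≤length {k = k} code xs covers =
  ∸-monoˡ-≤ 1 (2^k≤-of-injection (λ g → position g (nonempty? g))
                                  (λ g g' → position-injective (nonempty? g) (nonempty? g')))
  where
  nonempty? : (g : Sub k) → Dec (Nonempty g)
  nonempty? g = any? (λ i → g i ≟ true)

  position : (g : Sub k) → Dec (Nonempty g) → Fin (suc (length xs))
  position g (yes ne) = suc (Any.index (covers g ne))
  position g (no _)   = zero

  empty : ∀ {g} → ¬ Nonempty g → ∀ i → g i ≡ false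
  empty ¬ne i = ¬-not (λ gᵢ → ¬ne (i , gᵢ))

  position-injective : ∀ {g g'} (d : Dec (Nonempty g)) (d' : Dec (Nonempty g')) →
    position g d ≡ position g' d' → g ≗ g'
  position-injective (no ¬ne) (no ¬ne') _ i = ≡.trans (empty ¬ne i) (≡.sym (empty ¬ne' i))
  position-injective {g} {g'} (yes ne) (yes ne') same i =
    ≡.trans (≡.sym (lookup-index c i))
            (≡.subst (λ j → code (lookup xs j) ≗ g') (≡.sym (suc-injective same)) (lookup-index c') i)
    where
    c : Any (λ x → code x ≗ g) xs
    c = covers g ne

    c' : Any (λ x → code x ≗ g') xs
    c' = covers g' ne'

module Graph {c ℓ} (em : ∀ {p} → ExcludedMiddle p) (R : CommutativeRing c ℓ) where

  infix 4 _≐_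

  _≐_ : Vertex R → Vertex R → Set (c ⊔ ℓ)
  _≐_ = Defs._≐_ R

  Adj : Vertex R → Vertex R → Set (c ⊔ ℓ)
  Adj = Defs.Adj R

  Walk : Vertex R → Vertex R → ℕ → Set (lsuc (c ⊔ ℓ))
  Walk = Defs.Walk R

  Dist : Vertex R → Vertex R → ℕ∞ → Set (lsuc (c ⊔ ℓ))
  Dist = Defs.Dist R

  StronglyResolves : Vertex R → Vertex R → Vertex R → Set (lsuc (c ⊔ ℓ))
  StronglyResolves = Defs.StronglyResolves R

  -- _≐_ and Adj only see the underlying ideals, so a vertex is never
  -- determined by a proof about it: the lemmas below take vertices explicitly.
  ≐-refl : ∀ u → u ≐ u
  ≐-refl u x = id , id

  ≐-sym : ∀ u v → u ≐ v → v ≐ u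
  ≐-sym u v u≐v x = swap (u≐v x)

  ≐-trans : ∀ u v w → u ≐ v → v ≐ w → u ≐ w
  ≐-trans u v w u≐v v≐w x = proj₁ (v≐w x) ∘ proj₁ (u≐v x) , proj₂ (u≐v x) ∘ proj₂ (v≐w x)

  Adj-sym : ∀ u v → Adj u v → Adj v u
  Adj-sym u v (¬u≐v , x , x∈u , x∈v , x≉0) = ¬u≐v ∘ ≐-sym v u , x , x∈v , x∈u , x≉0

  Adj-respˡ : ∀ u u' v → u ≐ u' → Adj u v → Adj u' v
  Adj-respˡ u u' v u≐u' (¬u≐v , x , x∈u , x∈v , x≉0) =
    ¬u≐v ∘ ≐-trans u u' v u≐u' , x , proj₁ (u≐u' x) x∈u , x∈v , x≉0

  Adj-respʳ : ∀ u v v' → v ≐ v' → Adj u v → Adj u v'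
  Adj-respʳ u v v' v≐v' = Adj-sym v' u ∘ Adj-respˡ v v' u v≐v' ∘ Adj-sym u v

  Walk-resp : ∀ {u u' v v' k} → u ≐ u' → v ≐ v' → Walk u v k → Walk u' v' k
  Walk-resp {u} {u'} {v} {v'} u≐u' v≐v' (here u≐v) =
    here (≐-trans u' u v' (≐-sym u u' u≐u') (≐-trans u v v' u≐v v≐v'))
  Walk-resp {u} {u'} u≐u' v≐v' (step {w = x} a w) =
    step {w = x} (Adj-respˡ u u' x u≐u' a) (Walk-resp (≐-refl x) v≐v' w)

  Dist-resp : ∀ {u u' v v'} d → u ≐ u' → v ≐ v' → Dist u v d → Dist u' v' d
  Dist-resp {u} {u'} {v} {v'} (fin k) u≐u' v≐v' (w , minimal) =
    Walk-resp u≐u' v≐v' w , λ j j<k → minimal j j<k ∘ Walk-resp (≐-sym u u' u≐u') (≐-sym v v' v≐v')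
  Dist-resp {u} {u'} {v} {v'} ∞ u≐u' v≐v' none k =
    none k ∘ Walk-resp (≐-sym u u' u≐u') (≐-sym v v' v≐v')

  shortest : ∀ {u v} k → Walk u v k → ∃ λ a → Dist u v (fin a)
  shortest {u} {v} = <-rec (λ k → Walk u v k → ∃ λ a → Dist u v (fin a)) go
    where
    go : ∀ k → (∀ {j} → j < k → Walk u v j → ∃ λ a → Dist u v (fin a)) →
         Walk u v k → ∃ λ a → Dist u v (fin a)
    go k rec w with em {P = ∃ λ j → j < k × Walk u v j}
    ... | yes (j , j<k , w') = rec j<k w'
    ... | no ¬shorter        = k , w , λ j j<k w' → ¬shorter (j , j<k , w')

  Dist-exists : ∀ u v → ∃ (Dist u v)
  Dist-exists u v with em {P = ∃ (Walk u v)}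
  ... | yes (k , w) = let a , d = shortest k w in fin a , d
  ... | no ¬walk    = ∞ , λ k w → ¬walk (k , w)

  Dist-≤ : ∀ {u v a k} → Dist u v (fin a) → Walk u v k → a ≤ k
  Dist-≤ {k = k} (_ , minimal) w = ≮⇒≥ λ k<a → minimal k k<a w

  Dist-of-lower-bound : ∀ {u v k} → Walk u v k → (∀ {j} → Walk u v j → k ≤ j) → Dist u v (fin k)
  Dist-of-lower-bound w bound = w , λ j j<k w' → <⇒≱ j<k (bound w')

  walk-length≥1 : ∀ {u v k} → ¬ u ≐ v → Walk u v k → 1 ≤ k
  walk-length≥1 ¬u≐v (here u≐v) = contradiction u≐v ¬u≐v
  walk-length≥1 ¬u≐v (step _ _) = s≤s z≤n

  walk-length≥2 : ∀ {u v k} → ¬ u ≐ v → ¬ Adj u v → Walk u v k → 2 ≤ k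
  walk-length≥2 ¬u≐v ¬adj (here u≐v)          = contradiction u≐v ¬u≐v
  walk-length≥2 {u} {v} ¬u≐v ¬adj (step {w = x} a (here x≐v)) = contradiction (Adj-respʳ u x v x≐v a) ¬adj
  walk-length≥2 ¬u≐v ¬adj (step _ (step _ _)) = s≤s (s≤s z≤n)

  Adj⇒Dist₁ : ∀ {u v} → Adj u v → Dist u v (fin 1)
  Adj⇒Dist₁ {v = v} a = Dist-of-lower-bound (step {w = v} a (here (≐-refl v))) (walk-length≥1 (proj₁ a))

  path⇒Dist₂ : ∀ {u x v} → Adj u x → Adj x v → ¬ u ≐ v → ¬ Adj u v → Dist u v (fin 2)
  path⇒Dist₂ {x = x} {v} a b ¬u≐v ¬adj =
    Dist-of-lower-bound (step {w = x} a (step {w = v} b (here (≐-refl v)))) (walk-length≥2 ¬u≐v ¬adj)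

  StronglyResolves-sym : ∀ {w u v} → StronglyResolves w u v → StronglyResolves w v u
  StronglyResolves-sym = Sum.swap

  +∞-identityˡ : ∀ d → fin 0 +∞ d ≡ d
  +∞-identityˡ (fin k) = refl
  +∞-identityˡ ∞       = refl

  ≐⇒StronglyResolves : ∀ w u v → w ≐ u → StronglyResolves w u v
  ≐⇒StronglyResolves w u v w≐u =
    let d , Duv = Dist-exists u v in
    inj₂ (d , fin 0 , d , Dist-resp d (≐-sym w u w≐u) (≐-refl v) Duv , (here w≐u , λ _ ()) , Duv ,
          ≡.sym (+∞-identityˡ d))

  path⇒StronglyResolves : ∀ {w u v} → Adj w v → Adj v u → ¬ w ≐ u → ¬ Adj w u → StronglyResolves w u v
  path⇒StronglyResolves {v = v} wv vu ¬w≐u ¬wu =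
    inj₁ (fin 2 , fin 1 , fin 1 , path⇒Dist₂ {x = v} wv vu ¬w≐u ¬wu , Adj⇒Dist₁ wv , Adj⇒Dist₁ vu , refl)

  Near : Vertex R → Vertex R → Set (lsuc (c ⊔ ℓ))
  Near w u = ∃ λ k → k ≤ 2 × Walk w u k

  -- If d(v, u) ≥ 2 and w ≠ v, then d(w, v) + d(v, u) ≥ 3, so v is not on a
  -- geodesic from w to a vertex u within distance 2 of w.
  Near⇒¬geodesic-via-far : ∀ {w u v} → ¬ w ≐ v → ¬ v ≐ u → ¬ Adj v u → Near w u →
    ∀ a b d → Dist w u a → Dist w v b → Dist v u d → a ≢ b +∞ d
  Near⇒¬geodesic-via-far _ _ _ (k , _ , walk) ∞ _ _ Dwu _ _ _ = Dwu k walk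
  Near⇒¬geodesic-via-far ¬w≐v ¬v≐u ¬vu (k , k≤2 , walk) (fin _) (fin b) (fin d) Dwu Dwv Dvu refl =
    <-irrefl refl (≤-trans (≤-trans 3≤b+d (Dist-≤ Dwu walk)) k≤2)
    where
    3≤b+d : 3 ≤ b +ℕ d
    3≤b+d = +-mono-≤ (walk-length≥1 ¬w≐v (proj₁ Dwv)) (walk-length≥2 ¬v≐u ¬vu (proj₁ Dvu))
  Near⇒¬geodesic-via-far _ _ _ _ (fin _) (fin _) ∞ _ _ _ ()
  Near⇒¬geodesic-via-far _ _ _ _ (fin _) ∞ _ _ _ _ ()

  Near⇒¬StronglyResolves : ∀ {w} u v → ¬ u ≐ v → ¬ Adj u v → ¬ w ≐ u → ¬ w ≐ v →
    Near w u → Near w v → ¬ StronglyResolves w u v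
  Near⇒¬StronglyResolves u v ¬u≐v ¬uv ¬w≐u ¬w≐v near-u near-v (inj₁ (a , b , d , Dwu , Dwv , Dvu , eq)) =
    Near⇒¬geodesic-via-far ¬w≐v (¬u≐v ∘ ≐-sym v u) (¬uv ∘ Adj-sym v u) near-u a b d Dwu Dwv Dvu eq
  Near⇒¬StronglyResolves u v ¬u≐v ¬uv ¬w≐u ¬w≐v near-u near-v (inj₂ (a , b , d , Dwv , Dwu , Duv , eq)) =
    Near⇒¬geodesic-via-far ¬w≐u ¬u≐v ¬uv near-v a b d Dwv Dwu Duv eq

module ProductOfFields {c ℓ c' ℓ'} (em : ∀ {p} → ExcludedMiddle p) {n : ℕ}
  (R : CommutativeRing c ℓ) (F : Fin n → CommutativeRing c' ℓ')
  (isField : ∀ i → IsField (F i)) (iso : RingIsoToProduct R F) where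

  open Graph em R
  open RingIsoToProduct iso
  private
    module R = CommutativeRing R
    module F (i : Fin n) where
      open CommutativeRing (F i) public
      open IsField (isField i) public

  VanishesAt : R.Carrier → Fin n → Set ℓ'
  VanishesAt x i = F._≈_ i (φ x i) (F.0# i)

  φ-0 : ∀ i → VanishesAt R.0# i
  φ-0 i = identityʳ-unique (φ R.0# i) (φ R.0# i) (begin
    φ R.0# i + φ R.0# i    ≈⟨ φ-+ R.0# R.0# i ⟨
    φ (R.0# R.+ R.0#) i    ≈⟨ φ-cong (R.+-identityʳ R.0#) i ⟩
    φ R.0# i               ∎)
    where
    open F i
    open GroupProperties +-group using (identityʳ-unique)
    open import Relation.Binary.Reasoning.Setoid setoid

  ≈0⇒vanishes : ∀ {x} i → x R.≈ R.0# → VanishesAt x i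
  ≈0⇒vanishes i x≈0 = F.trans i (φ-cong x≈0 i) (φ-0 i)

  vanishes⇒≈0 : ∀ {x} → (∀ i → VanishesAt x i) → x R.≈ R.0#
  vanishes⇒≈0 vanishes = φ-injective λ i → F.trans i (vanishes i) (F.sym i (φ-0 i))

  ≉0⇒nonvanishing : ∀ {x} → ¬ x R.≈ R.0# → ∃ λ i → ¬ VanishesAt x i
  ≉0⇒nonvanishing x≉0 = decidable-stable em λ ¬nonvanishing →
    x≉0 (vanishes⇒≈0 λ i → decidable-stable em λ ¬vanishes → ¬nonvanishing (i , ¬vanishes))

  𝟙 : ∀ i → Bool → F.Carrier i
  𝟙 i b = if b then F.1# i else F.0# i

  e : Sub n → R.Carrier
  e S = proj₁ (φ-surjective λ i → 𝟙 i (S i))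

  φ-e : ∀ S i → F._≈_ i (φ (e S) i) (𝟙 i (S i))
  φ-e S = proj₂ (φ-surjective λ i → 𝟙 i (S i))

  φ-e-true : ∀ {S i} → S i ≡ true → F._≈_ i (φ (e S) i) (F.1# i)
  φ-e-true {S} {i} Sᵢ = ≡.subst (λ b → F._≈_ i (φ (e S) i) (𝟙 i b)) Sᵢ (φ-e S i)

  e-vanishes : ∀ {S i} → S i ≡ false → VanishesAt (e S) i
  e-vanishes {S} {i} Sᵢ = ≡.subst (λ b → F._≈_ i (φ (e S) i) (𝟙 i b)) Sᵢ (φ-e S i)

  e-nonvanishing : ∀ {S i} → S i ≡ true → ¬ VanishesAt (e S) i
  e-nonvanishing {i = i} Sᵢ vanishes = F.0≉1 i (F.trans i (F.sym i vanishes) (φ-e-true Sᵢ))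

  e-cong : ∀ {S T} → S ≗ T → e S R.≈ e T
  e-cong {S} {T} S≗T = φ-injective λ i →
    F.trans i (φ-e S i) (F.trans i (F.reflexive i (≡.cong (𝟙 i) (S≗T i))) (F.sym i (φ-e T i)))

  e-∅ : ∀ {S} → (∀ i → S i ≡ false) → e S R.≈ R.0#
  e-∅ empty = vanishes⇒≈0 (e-vanishes ∘ empty)

  𝟙-∨ : ∀ i a b → F._≈_ i (𝟙 i (a ∨ b)) (F._+_ i (𝟙 i a) (F._*_ i (𝟙 i (not a)) (𝟙 i b)))
  𝟙-∨ i true  b = F.sym i (F.trans i (F.+-congˡ i (F.zeroˡ i (𝟙 i b))) (F.+-identityʳ i (F.1# i)))
  𝟙-∨ i false b = F.sym i (F.trans i (F.+-identityˡ i _) (F.*-identityˡ i (𝟙 i b)))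

  e-∪ : ∀ S T → e (S ∪ T) R.≈ e S R.+ e (not ∘ S) R.* e T
  e-∪ S T = φ-injective pointwise
    where
    pointwise : ∀ i → F._≈_ i (φ (e (S ∪ T)) i) (φ (e S R.+ e (not ∘ S) R.* e T) i)
    pointwise i = begin
      φ (e (S ∪ T)) i                                ≈⟨ φ-e (S ∪ T) i ⟩
      𝟙 i (S i ∨ T i)                                ≈⟨ 𝟙-∨ i (S i) (T i) ⟩
      𝟙 i (S i) + 𝟙 i (not (S i)) * 𝟙 i (T i)        ≈⟨ +-cong (φ-e S i) (*-cong (φ-e (not ∘ S) i) (φ-e T i)) ⟨
      φ (e S) i + φ (e (not ∘ S)) i * φ (e T) i      ≈⟨ +-congˡ (φ-* (e (not ∘ S)) (e T) i) ⟨
      φ (e S) i + φ (e (not ∘ S) R.* e T) i          ≈⟨ φ-+ (e S) (e (not ∘ S) R.* e T) i ⟨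
      φ (e S R.+ e (not ∘ S) R.* e T) i              ∎
      where
      open F i
      open import Relation.Binary.Reasoning.Setoid setoid

  infix 4 _∈_ _∈ᵛ_

  _∈_ : R.Carrier → Ideal R → Set (c ⊔ ℓ)
  x ∈ J = Ideal._∈I J x

  _∈ᵛ_ : R.Carrier → Vertex R → Set (c ⊔ ℓ)
  x ∈ᵛ u = x ∈ proj₁ u

  -- The principal ideal (e S): the elements vanishing outside S.
  I : Sub n → Ideal R
  I S = record
    { _∈I      = λ x → Lift c (x R.* e S R.≈ x)
    ; ∈-resp   = λ x≈y (lift x·e≈x) → lift (R.trans (R.*-congʳ (R.sym x≈y)) (R.trans x·e≈x x≈y))
    ; 0∈       = lift (R.zeroˡ (e S))
    ; +-closed = λ (lift x·e≈x) (lift y·e≈y) → lift (R.trans (R.distribʳ (e S) _ _) (R.+-cong x·e≈x y·e≈y))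
    ; *-closed = λ r (lift x·e≈x) → lift (R.trans (R.*-assoc r _ (e S)) (R.*-congˡ x·e≈x))
    }

  ∈I⇒vanishes : ∀ {x S i} → x ∈ I S → S i ≡ false → VanishesAt x i
  ∈I⇒vanishes {x} {S} {i} (lift x·e≈x) Sᵢ = begin
    φ x i                  ≈⟨ φ-cong x·e≈x i ⟨
    φ (x R.* e S) i        ≈⟨ φ-* x (e S) i ⟩
    φ x i * φ (e S) i      ≈⟨ *-congˡ (e-vanishes Sᵢ) ⟩
    φ x i * 0#             ≈⟨ zeroʳ (φ x i) ⟩
    0#                     ∎
    where
    open F i
    open import Relation.Binary.Reasoning.Setoid setoid

  vanishes⇒∈I : ∀ {x S} → (∀ i → S i ≡ false → VanishesAt x i) → x ∈ I S
  vanishes⇒∈I {x} {S} vanishes = lift (φ-injective λ i → F.trans i (φ-* x (e S) i) (keeps i))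
    where
    keeps : ∀ i → F._≈_ i (F._*_ i (φ x i) (φ (e S) i)) (φ x i)
    keeps i with S i in Sᵢ
    ... | true  = F.trans i (F.*-congˡ i (φ-e-true Sᵢ)) (F.*-identityʳ i (φ x i))
    ... | false = F.trans i (F.*-congˡ i (e-vanishes Sᵢ)) (F.trans i (F.zeroʳ i (φ x i)) (F.sym i (vanishes i Sᵢ)))

  e∈I : ∀ S → e S ∈ I S
  e∈I S = vanishes⇒∈I λ _ → e-vanishes

  vertex : (S : Sub n) → Nonempty S → Proper S → Vertex R
  vertex S (i , Sᵢ) (k , Sₖ) = I S , (e S , e∈I S , e-nonvanishing Sᵢ ∘ ≈0⇒vanishes i) , 1∉I
    where
    1∉I : ¬ R.1# ∈ I S
    1∉I 1∈I = F.0≉1 k (F.trans k (F.sym k (∈I⇒vanishes 1∈I Sₖ)) (φ-1 k))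

  Supported : Vertex R → Fin n → Set (c ⊔ ℓ ⊔ ℓ')
  Supported u i = ∃ λ x → x ∈ᵛ u × ¬ VanishesAt x i

  supp : Vertex R → Sub n
  supp u i = does (em {P = Supported u i})

  supp-true : ∀ {x} u i → x ∈ᵛ u → ¬ VanishesAt x i → supp u i ≡ true
  supp-true {x} u i x∈u x≉0 = dec-true em (x , x∈u , x≉0)

  supp-witness : ∀ u i → supp u i ≡ true → Supported u i
  supp-witness u i uᵢ = decidable-stable em λ ¬supported →
    contradiction (≡.trans (≡.sym uᵢ) (dec-false em ¬supported)) λ ()

  supp-false⇒vanishes : ∀ {x} u i → x ∈ᵛ u → supp u i ≡ false → VanishesAt x i
  supp-false⇒vanishes u i x∈u uᵢ = decidable-stable em λ x≉0 →
    contradiction (≡.trans (≡.sym uᵢ) (supp-true u i x∈u x≉0)) λ ()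

  -- A classical inverse, junk value 0 at 0.
  inv : ∀ i → F.Carrier i → F.Carrier i
  inv i a with em {P = F._≈_ i a (F.0# i)}
  ... | yes _   = F.0# i
  ... | no a≉0 = proj₁ (F.inverse i a a≉0)

  inv-inverseʳ : ∀ i {a} → ¬ F._≈_ i a (F.0# i) → F._≈_ i (F._*_ i a (inv i a)) (F.1# i)
  inv-inverseʳ i {a} a≉0 with em {P = F._≈_ i a (F.0# i)}
  ... | yes a≈0  = contradiction a≈0 a≉0
  ... | no a≉0′ = proj₂ (F.inverse i a a≉0′)

  ∈ᵛ-resp : ∀ u {x y} → x R.≈ y → x ∈ᵛ u → y ∈ᵛ u
  ∈ᵛ-resp u = ∈-resp (proj₁ u)

  e∈-of-nonvanishing : ∀ {y} u S → y ∈ᵛ u → (∀ i → S i ≡ true → ¬ VanishesAt y i) → e S ∈ᵛ u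
  e∈-of-nonvanishing {y} u S y∈u nonvanishing =
    ∈ᵛ-resp u (φ-injective pointwise) (*-closed (proj₁ u) (e S R.* y⁻¹) y∈u)
    where
    y⁻¹ : R.Carrier
    y⁻¹ = proj₁ (φ-surjective λ i → inv i (φ y i))

    pointwise : ∀ i → F._≈_ i (φ (e S R.* y⁻¹ R.* y) i) (φ (e S) i)
    pointwise i = begin
      φ (e S R.* y⁻¹ R.* y) i                 ≈⟨ φ-* (e S R.* y⁻¹) y i ⟩
      φ (e S R.* y⁻¹) i * φ y i               ≈⟨ *-congʳ (φ-* (e S) y⁻¹ i) ⟩
      φ (e S) i * φ y⁻¹ i * φ y i             ≈⟨ *-congʳ (*-congˡ (proj₂ (φ-surjective _) i)) ⟩
      φ (e S) i * inv i (φ y i) * φ y i       ≈⟨ *-assoc _ _ _ ⟩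
      φ (e S) i * (inv i (φ y i) * φ y i)     ≈⟨ cancel ⟩
      φ (e S) i                               ∎
      where
      open F i
      open import Relation.Binary.Reasoning.Setoid setoid

      cancel : φ (e S) i * (inv i (φ y i) * φ y i) ≈ φ (e S) i
      cancel with S i in Sᵢ
      ... | true  = trans (*-congˡ (trans (*-comm _ _) (inv-inverseʳ i (nonvanishing i Sᵢ))))
                          (*-identityʳ (φ (e S) i))
      ... | false = trans (*-congʳ (e-vanishes Sᵢ)) (trans (zeroˡ _) (sym (e-vanishes Sᵢ)))

  e∪∈ : ∀ u {S T} → e S ∈ᵛ u → e T ∈ᵛ u → e (S ∪ T) ∈ᵛ u
  e∪∈ u {S} {T} eS∈u eT∈u =
    ∈ᵛ-resp u (R.sym (e-∪ S T)) (+-closed (proj₁ u) eS∈u (*-closed (proj₁ u) (e (not ∘ S)) eT∈u))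

  e∅∈ : ∀ u {S} → (∀ i → S i ≡ false) → e S ∈ᵛ u
  e∅∈ u empty = ∈ᵛ-resp u (R.sym (e-∅ empty)) (0∈ (proj₁ u))

  below at : ℕ → Sub n
  below k i = toℕ i <ᵇ k
  at    k i = toℕ i ≡ᵇ k

  at⇒≡ : ∀ {k} i → at k i ≡ true → toℕ i ≡ k
  at⇒≡ {k} i atᵢ = ≡ᵇ⇒≡ (toℕ i) k (Equivalence.from T-≡ atᵢ)

  -- supp u ∩ at k has at most one element, which is supported by a single witness.
  e-supp∩at∈ : ∀ u k → e (supp u ∩ at k) ∈ᵛ u
  e-supp∩at∈ u k with em {P = ∃ λ j → supp u j ≡ true × toℕ j ≡ k}
  ... | yes (j , uⱼ , j≡k) =
    let y , y∈u , yⱼ≉0 = supp-witness u j uⱼ in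
    e∈-of-nonvanishing u (supp u ∩ at k) y∈u λ i uᵢ∧atᵢ →
      ≡.subst (¬_ ∘ VanishesAt y) (toℕ-injective (≡.trans j≡k (≡.sym (at⇒≡ i (proj₂ (∧≡true uᵢ∧atᵢ)))))) yⱼ≉0
  ... | no ¬j = e∅∈ u λ i → ¬-not λ uᵢ∧atᵢ →
    let uᵢ , atᵢ = ∧≡true uᵢ∧atᵢ in ¬j (i , uᵢ , at⇒≡ i atᵢ)

  e-supp∩below∈ : ∀ u k → e (supp u ∩ below k) ∈ᵛ u
  e-supp∩below∈ u zero    = e∅∈ u λ i → ∧-zeroʳ (supp u i)
  e-supp∩below∈ u (suc k) =
    ∈ᵛ-resp u (R.sym (e-cong split)) (e∪∈ u (e-supp∩below∈ u k) (e-supp∩at∈ u k))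
    where
    split : supp u ∩ below (suc k) ≗ (supp u ∩ below k) ∪ (supp u ∩ at k)
    split i = ≡.trans (≡.cong (supp u i ∧_) (<ᵇ-suc (toℕ i) k)) (∧-distribˡ-∨ (supp u i) _ _)

  e-supp∈ : ∀ u → e (supp u) ∈ᵛ u
  e-supp∈ u = ∈ᵛ-resp u (e-cong everything-below-n) (e-supp∩below∈ u n)
    where
    everything-below-n : supp u ∩ below n ≗ supp u
    everything-below-n i =
      ≡.trans (≡.cong (supp u i ∧_) (Equivalence.to T-≡ (<⇒<ᵇ (toℕ<n i)))) (∧-identityʳ (supp u i))

  vanishes⇒∈ : ∀ {x} u → (∀ i → supp u i ≡ false → VanishesAt x i) → x ∈ᵛ u
  vanishes⇒∈ {x} u vanishes =
    ∈ᵛ-resp u (lower (vanishes⇒∈I vanishes)) (*-closed (proj₁ u) x (e-supp∈ u))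

  e⊆∈ : ∀ u {S} → (∀ i → supp u i ≡ false → S i ≡ false) → e S ∈ᵛ u
  e⊆∈ u S⊆supp = vanishes⇒∈ u λ i uᵢ → e-vanishes (S⊆supp i uᵢ)

  supp-vertex : ∀ S ne pr → supp (vertex S ne pr) ≗ S
  supp-vertex S ne pr j with S j in Sⱼ
  ... | true  = supp-true (vertex S ne pr) j (e∈I S) (e-nonvanishing Sⱼ)
  ... | false = ¬-not λ uⱼ →
    let x , x∈u , xⱼ≉0 = supp-witness (vertex S ne pr) j uⱼ in xⱼ≉0 (∈I⇒vanishes x∈u Sⱼ)

  supp-nonempty : ∀ u → Nonempty (supp u)
  supp-nonempty u =
    let x , x∈u , x≉0 = proj₁ (proj₂ u) ; i , xᵢ≉0 = ≉0⇒nonvanishing x≉0 in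
    i , supp-true u i x∈u xᵢ≉0

  supp-≗⇒≐ : ∀ u v → supp u ≗ supp v → u ≐ v
  supp-≗⇒≐ u v u≗v x =
    (λ x∈u → vanishes⇒∈ v λ i vᵢ → supp-false⇒vanishes u i x∈u (≡.trans (u≗v i) vᵢ)) ,
    (λ x∈v → vanishes⇒∈ u λ i uᵢ → supp-false⇒vanishes v i x∈v (≡.trans (≡.sym (u≗v i)) uᵢ))

  supp-resp : ∀ u v → u ≐ v → ∀ i → supp u i ≡ true → supp v i ≡ true
  supp-resp u v u≐v i uᵢ = let x , x∈u , xᵢ≉0 = supp-witness u i uᵢ in supp-true v i (proj₁ (u≐v x) x∈u) xᵢ≉0

  ≐⇒supp-≗ : ∀ u v → u ≐ v → supp u ≗ supp v
  ≐⇒supp-≗ u v u≐v i = ⇔→≡ (mk⇔ (supp-resp u v u≐v i) (supp-resp v u (≐-sym u v u≐v) i))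

  Adj⇒Meet : ∀ u v → Adj u v → Meet (supp u) (supp v)
  Adj⇒Meet u v (_ , x , x∈u , x∈v , x≉0) =
    let i , xᵢ≉0 = ≉0⇒nonvanishing x≉0 in i , supp-true u i x∈u xᵢ≉0 , supp-true v i x∈v xᵢ≉0

  Meet⇒Adj : ∀ u v → ¬ u ≐ v → Meet (supp u) (supp v) → Adj u v
  Meet⇒Adj u v ¬u≐v (i , uᵢ , vᵢ) =
    ¬u≐v , e (supp u ∩ supp v) ,
    e⊆∈ u (λ j uⱼ → ≡.cong (_∧ supp v j) uⱼ) ,
    e⊆∈ v (λ j vⱼ → ≡.trans (≡.cong (supp u j ∧_) vⱼ) (∧-zeroʳ (supp u j))) ,
    e-nonvanishing (≡.cong₂ _∧_ uᵢ vᵢ) ∘ ≈0⇒vanishes i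

  ≐-differ : ∀ u v i → supp u i ≡ true → supp v i ≡ false → ¬ u ≐ v
  ≐-differ u v i uᵢ vᵢ u≐v = contradiction (≡.trans (≡.sym uᵢ) (≡.trans (≐⇒supp-≗ u v u≐v i) vᵢ)) λ ()

  -- The union of two disjoint supports that leave a coordinate uncovered is a
  -- common neighbour.
  disjoint⇒Near : ∀ w u → (∀ k → supp w k ≡ true → supp u k ≡ false) →
    (∃ λ k → supp w k ≡ false × supp u k ≡ false) → Near w u
  disjoint⇒Near w u disjoint (k , wₖ , uₖ) =
    2 , ≤-refl , step {w = X} (Meet⇒Adj w X ¬w≐X (i , wᵢ , Xᵢ))
                   (step {w = u} (Meet⇒Adj X u ¬X≐u (j , Xⱼ , uⱼ)) (here (≐-refl u)))
    where
    i : Fin n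
    i = proj₁ (supp-nonempty w)

    wᵢ : supp w i ≡ true
    wᵢ = proj₂ (supp-nonempty w)

    j : Fin n
    j = proj₁ (supp-nonempty u)

    uⱼ : supp u j ≡ true
    uⱼ = proj₂ (supp-nonempty u)

    nonempty : Nonempty (supp w ∪ supp u)
    nonempty = i , ≡.cong (_∨ supp u i) wᵢ

    proper : Proper (supp w ∪ supp u)
    proper = k , ≡.cong₂ _∨_ wₖ uₖ

    X : Vertex R
    X = vertex (supp w ∪ supp u) nonempty proper

    Xᵢ : supp X i ≡ true
    Xᵢ = ≡.trans (supp-vertex _ nonempty proper i) (proj₂ nonempty)

    Xⱼ : supp X j ≡ true
    Xⱼ = ≡.trans (supp-vertex _ nonempty proper j) (≡.trans (≡.cong (supp w j ∨_) uⱼ) (∨-zeroʳ (supp w j)))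

    ¬w≐X : ¬ w ≐ X
    ¬w≐X = ≐-differ X w j Xⱼ (¬-not λ wⱼ → contradiction (≡.trans (≡.sym uⱼ) (disjoint j wⱼ)) λ ()) ∘ ≐-sym w X

    ¬X≐u : ¬ X ≐ u
    ¬X≐u = ≐-differ X u i Xᵢ (disjoint i wᵢ)

  Near-of-supports : ∀ w u → ¬ w ≐ u → ¬ supp w ≗ not ∘ supp u → Near w u
  Near-of-supports w u ¬w≐u ¬w≗∁u with em {P = Meet (supp w) (supp u)}
  ... | yes meet = 1 , s≤s z≤n , step {w = u} (Meet⇒Adj w u ¬w≐u meet) (here (≐-refl u))
  ... | no ¬meet = disjoint⇒Near w u disjoint (let k , ≢ = differ in k , false-both (disjoint k) ≢)
    where
    disjoint : ∀ k → supp w k ≡ true → supp u k ≡ false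
    disjoint k wₖ = ¬-not λ uₖ → ¬meet (k , wₖ , uₖ)

    differ : ∃ λ k → supp w k ≢ not (supp u k)
    differ = decidable-stable em λ ¬differ → ¬w≗∁u λ k → decidable-stable em λ ≢ → ¬differ (k , ≢)

  -- Any other vertex is within distance 2 of both, which are at distance at least 2.
  complement-resolvers : ∀ u u' w → supp u' ≗ not ∘ supp u → StronglyResolves w u u' → w ≐ u ⊎ w ≐ u'
  complement-resolvers u u' w u'≗∁u resolves with em {P = w ≐ u} | em {P = w ≐ u'}
  ... | yes w≐u | _         = inj₁ w≐u
  ... | no _    | yes w≐u'  = inj₂ w≐u'
  ... | no ¬w≐u | no ¬w≐u' =
    contradiction resolves (Near⇒¬StronglyResolves u u' ¬u≐u' ¬uu' ¬w≐u ¬w≐u' near-u near-u')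
    where
    ¬u≐u' : ¬ u ≐ u'
    ¬u≐u' = let j , uⱼ = supp-nonempty u in ≐-differ u u' j uⱼ (≡.trans (u'≗∁u j) (≡.cong not uⱼ))

    ¬uu' : ¬ Adj u u'
    ¬uu' adj = let i , uᵢ , u'ᵢ = Adj⇒Meet u u' adj in
      contradiction (≡.trans (≡.sym u'ᵢ) (≡.trans (u'≗∁u i) (≡.cong not uᵢ))) λ ()

    near-u : Near w u
    near-u = Near-of-supports w u ¬w≐u λ w≗∁u →
      ¬w≐u' (supp-≗⇒≐ w u' λ i → ≡.trans (w≗∁u i) (≡.sym (u'≗∁u i)))

    near-u' : Near w u'
    near-u' = Near-of-supports w u' ¬w≐u' λ w≗∁u' →
      ¬w≐u (supp-≗⇒≐ w u λ i → ≡.trans (w≗∁u' i) (≡.trans (≡.cong not (u'≗∁u i)) (not-involutive (supp u i))))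

  disjoint⇒StronglyResolves : ∀ w u v → (∀ k → supp w k ≡ true → supp u k ≡ false) →
    Meet (supp w) (supp v) → Meet (supp u) (supp v) → ¬ u ≐ v → StronglyResolves w u v
  disjoint⇒StronglyResolves w u v disjoint (i , wᵢ , vᵢ) (o , uₒ , vₒ) ¬u≐v =
    path⇒StronglyResolves (Meet⇒Adj w v ¬w≐v (i , wᵢ , vᵢ)) (Meet⇒Adj v u (¬u≐v ∘ ≐-sym v u) (o , vₒ , uₒ))
                          ¬w≐u ¬wu
    where
    ¬w≐v : ¬ w ≐ v
    ¬w≐v = ≐-differ v w o vₒ (¬-not λ wₒ → contradiction (≡.trans (≡.sym uₒ) (disjoint o wₒ)) λ ()) ∘ ≐-sym w v

    ¬w≐u : ¬ w ≐ u
    ¬w≐u = ≐-differ w u i wᵢ (disjoint i wᵢ)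

    ¬wu : ¬ Adj w u
    ¬wu adj = let k , wₖ , uₖ = Adj⇒Meet w u adj in contradiction (≡.trans (≡.sym uₖ) (disjoint k wₖ)) λ ()

module SDimOfProduct {c ℓ c' ℓ'} (em : ∀ {p} → ExcludedMiddle p) {m : ℕ}
  (R : CommutativeRing c ℓ) (F : Fin (suc m) → CommutativeRing c' ℓ')
  (isField : ∀ i → IsField (F i)) (iso : RingIsoToProduct R F) where

  open Graph em R
  open ProductOfFields em R F isField iso

  resolvingSet : List (Vertex R)
  resolvingSet = map (λ (g , i , gᵢ) → vertex (false Vec.∷ g) (suc i , gᵢ) (zero , refl)) (nonemptySubsets m)

  length-resolvingSet : length resolvingSet ≡ 2 ^ m ∸ 1
  length-resolvingSet = ≡.trans (length-map _ (nonemptySubsets m)) (length-nonemptySubsets m)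

  ∈-resolvingSet : ∀ S → S zero ≡ false → Nonempty S → Any (λ w → supp w ≗ S) resolvingSet
  ∈-resolvingSet S S₀ ne =
    map⁺ (Any.map (λ { {g , j , gⱼ} g≗tail i →
                        ≡.trans (supp-vertex (false Vec.∷ g) (suc j , gⱼ) (zero , refl) i) (∷-≗ {g = S} (≡.sym S₀) g≗tail i) })
                  (∈-nonemptySubsets (tail S) (tail-nonempty {S = S} S₀ ne)))

  -- When 0 lies in both supports, the part of one support missing from the
  -- other avoids 0, hence is the support of a vertex of the resolving set.
  difference-resolves : ∀ u v → supp u zero ≡ true → supp v zero ≡ true →
    ∀ i → supp u i ≡ false → supp v i ≡ true → ¬ u ≐ v → Any (λ w → StronglyResolves w u v) resolvingSet
  difference-resolves u v u₀ v₀ i uᵢ vᵢ ¬u≐v =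
    Any.map (λ {w} w≗v∖u → disjoint⇒StronglyResolves w u v (disjoint {w} w≗v∖u)
                             (i , ≡.trans (w≗v∖u i) v∖uᵢ , vᵢ) (zero , u₀ , v₀) ¬u≐v)
            (∈-resolvingSet (supp v ∖ supp u) v∖u₀ (i , v∖uᵢ))
    where
    v∖u₀ : (supp v ∖ supp u) zero ≡ false
    v∖u₀ = ≡.cong₂ (λ a b → a ∧ not b) v₀ u₀

    v∖uᵢ : (supp v ∖ supp u) i ≡ true
    v∖uᵢ = ≡.cong₂ (λ a b → a ∧ not b) vᵢ uᵢ

    disjoint : ∀ {w} → supp w ≗ supp v ∖ supp u → ∀ k → supp w k ≡ true → supp u k ≡ false
    disjoint w≗v∖u k wₖ = not-injective (proj₂ (∧≡true (≡.trans (≡.sym (w≗v∖u k)) wₖ)))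

  zero-in-both-resolved : ∀ u v → supp u zero ≡ true → supp v zero ≡ true → ¬ u ≐ v →
    Any (λ w → StronglyResolves w u v) resolvingSet
  zero-in-both-resolved u v u₀ v₀ ¬u≐v with differ
    where
    differ : ∃ λ i → supp u i ≢ supp v i
    differ = decidable-stable em λ ¬differ → ¬u≐v (supp-≗⇒≐ u v λ i → decidable-stable em λ ≢ → ¬differ (i , ≢))
  ... | i , uᵢ≢vᵢ with supp v i in vᵢ
  ...   | true  = difference-resolves u v u₀ v₀ i (¬-not uᵢ≢vᵢ) vᵢ ¬u≐v
  ...   | false = Any.map StronglyResolves-sym
                    (difference-resolves v u v₀ u₀ i vᵢ (¬-not uᵢ≢vᵢ) (¬u≐v ∘ ≐-sym v u))

  resolvingSet-resolving : StrongResolving R resolvingSet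
  resolvingSet-resolving u v ¬u≐v with supp u zero in u₀ | supp v zero in v₀
  ... | false | _     = Any.map (λ {w} w≗u → ≐⇒StronglyResolves w u v (supp-≗⇒≐ w u w≗u))
                          (∈-resolvingSet (supp u) u₀ (supp-nonempty u))
  ... | true  | false = Any.map (λ {w} w≗v → StronglyResolves-sym (≐⇒StronglyResolves w v u (supp-≗⇒≐ w v w≗v)))
                          (∈-resolvingSet (supp v) v₀ (supp-nonempty v))
  ... | true  | true  = zero-in-both-resolved u v u₀ v₀ ¬u≐v

  -- Membership of j + 1 relative to that of 0: a support and its complement
  -- decode to the same subset of Fin m.
  decode : Sub (suc m) → Sub m
  decode S j = S zero xor S (suc j)

  decode-cong : ∀ {S T} → S ≗ T → decode S ≗ decode T
  decode-cong S≗T j = ≡.cong₂ _xor_ (S≗T zero) (S≗T (suc j))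

  resolving⇒2^m∸1≤length : ∀ W → StrongResolving R W → 2 ^ m ∸ 1 ≤ length W
  resolving⇒2^m∸1≤length W resolving = covering⇒2^k∸1≤length (decode ∘ supp) W covers
    where
    covers : ∀ g → Nonempty g → Any (λ w → decode (supp w) ≗ g) W
    covers g (i , gᵢ) = Any.map (λ {w} → decodes w ∘ complement-resolvers u u' w u'≗∁u) (resolving u u' ¬u≐u')
      where
      u u' : Vertex R
      u  = vertex (false Vec.∷ g) (suc i , gᵢ) (zero , refl)
      u' = vertex (true Vec.∷ (not ∘ g)) (zero , refl) (suc i , ≡.cong not gᵢ)

      supp-u : supp u ≗ false Vec.∷ g
      supp-u = supp-vertex _ (suc i , gᵢ) (zero , refl)

      supp-u' : supp u' ≗ true Vec.∷ (not ∘ g)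
      supp-u' = supp-vertex _ (zero , refl) (suc i , ≡.cong not gᵢ)

      u'≗∁u : supp u' ≗ not ∘ supp u
      u'≗∁u zero    = ≡.trans (supp-u' zero) (≡.cong not (≡.sym (supp-u zero)))
      u'≗∁u (suc j) = ≡.trans (supp-u' (suc j)) (≡.cong not (≡.sym (supp-u (suc j))))

      ¬u≐u' : ¬ u ≐ u'
      ¬u≐u' = ≐-differ u' u zero (supp-u' zero) (supp-u zero) ∘ ≐-sym u u'

      decodes : ∀ w → w ≐ u ⊎ w ≐ u' → decode (supp w) ≗ g
      decodes w (inj₁ w≐u)  j = decode-cong (λ k → ≡.trans (≐⇒supp-≗ w u w≐u k) (supp-u k)) j
      decodes w (inj₂ w≐u') j =
        ≡.trans (decode-cong (λ k → ≡.trans (≐⇒supp-≗ w u' w≐u' k) (supp-u' k)) j) (not-involutive (g j))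

  sdim : SDim R (2 ^ m ∸ 1)
  sdim = (resolvingSet , length-resolvingSet , resolvingSet-resolving) , resolving⇒2^m∸1≤length

2^[1+m]∸2^m≡2^m : ∀ m → 2 ^ suc m ∸ 2 ^ m ≡ 2 ^ m
2^[1+m]∸2^m≡2^m m = ≡.trans (m+n∸m≡n (2 ^ m) (2 ^ m +ℕ 0)) (+-identityʳ (2 ^ m))

theorem2p9 : ∀ {c ℓ c' ℓ'} → (∀ {p} → ExcludedMiddle p) →
    (n : ℕ) → 2 ≤ n →
    (R : CommutativeRing c ℓ) (F : Fin n → CommutativeRing c' ℓ') →
    (∀ i → IsField (F i)) → RingIsoToProduct R F →
    SDim R (2 ^ n ∸ 2 ^ (n ∸ 1) ∸ 1)
-- The argument only needs n ≥ 1.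
theorem2p9 em (suc m) _ R F isField iso =
  ≡.subst (λ k → SDim R (k ∸ 1)) (≡.sym (2^[1+m]∸2^m≡2^m m)) (SDimOfProduct.sdim em R F isField iso)
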